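{- Let $\alpha > 0$, let $T$ be an $n$-vertex tournament that is $\alpha$-far from being transitive, and let $\sigma$ be an ordering of $V(T)$ that minimises the number of backward edges. Then either (1) $T$ contains at least $\alpha n^2/1000$ backward edges in $\sigma$ each of length at least $n/50$, or (2) $T$ contains a subtournament on at least $n/20$ vertices that is $6\alpha$-far from being transitive.
   Context: A tournament on $n$ vertices is $\delta$-far from being transitive if the orientations of at least $\delta n^2$ of its edges must be reversed to make it transitive (a tournament is transitive if some linear ordering of its vertices has all edges pointing forward). For an ordering $\sigma = (v_1, \dots, v_n)$ of the vertex set, an edge directed from $v_i$ to $v_j$ is a forward edge if $i < j$ and a backward edge otherwise. The length of an edge between $v_i$ and $v_j$ is $|j - i|$.
   Formalization: The parameter α is a positive rational number. -}

module Defs where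

open import Data.Nat as ℕ using (ℕ; zero; suc; _+_; _*_; _∸_; _<ᵇ_; _≤ᵇ_)
open import Data.Fin using (Fin; toℕ)
import Data.Fin as Fin
open import Data.Bool using (Bool; true; false; if_then_else_; _∧_; not; _xor_)
open import Data.Fin.Permutation using (Permutation′; _⟨$⟩ʳ_)
open import Data.Product using (∃; _×_)
open import Data.Integer using (+_)
open import Data.Rational using (ℚ; _/_; _≤_) renaming (_*_ to _*ℚ_)
open import Relation.Binary.PropositionalEquality using (_≡_; _≢_)

-- A tournament on vertex set Fin n, given by its adjacency relation:
-- adj u v ≡ true means the edge between u and v is directed from u to v.
Adj : ℕ → Set
Adj n = Fin n → Fin n → Bool

IsTournament : ∀ {n} → Adj n → Set
IsTournament {n} T = (∀ u → T u u ≡ false) × (∀ u v → u ≢ v → T u v ≡ not (T v u))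

count : ∀ {n} → (Fin n → Bool) → ℕ
count {zero}  f = 0
count {suc n} f = (if f Fin.zero then 1 else 0) + count (λ i → f (Fin.suc i))

sumFin : ∀ {n} → (Fin n → ℕ) → ℕ
sumFin {zero}  f = 0
sumFin {suc n} f = f Fin.zero + sumFin (λ i → f (Fin.suc i))

-- An ordering σ = (v_1,…,v_n) of the vertices: position p ↦ vertex σ ⟨$⟩ʳ p.
Ordering : ℕ → Set
Ordering n = Permutation′ n

IsBackward : ∀ {n} → Adj n → Ordering n → Fin n → Fin n → Bool
IsBackward T σ p q = (toℕ q <ᵇ toℕ p) ∧ T (σ ⟨$⟩ʳ p) (σ ⟨$⟩ʳ q)

backward : ∀ {n} → Adj n → Ordering n → ℕ
backward T σ = sumFin (λ p → count (λ q → IsBackward T σ p q))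

-- number of backward edges of T in σ of length (= p - q) at least L/K,
-- i.e. with K * (p - q) ≥ L
backwardLong : ∀ {n} → Adj n → Ordering n → (L K : ℕ) → ℕ
backwardLong T σ L K =
  sumFin (λ p → count (λ q → IsBackward T σ p q ∧ (L ≤ᵇ K * (toℕ p ∸ toℕ q))))

IsMinimalOrdering : ∀ {n} → Adj n → Ordering n → Set
IsMinimalOrdering {n} T σ = ∀ (τ : Ordering n) → backward T σ ℕ.≤ backward T τ

IsTransitive : ∀ {n} → Adj n → Set
IsTransitive {n} T = ∃ λ (σ : Ordering n) →
  ∀ p q → T (σ ⟨$⟩ʳ p) (σ ⟨$⟩ʳ q) ≡ true → toℕ p ℕ.< toℕ q

differ : ∀ {n} → Adj n → Adj n → ℕ
differ T T' = sumFin (λ u → count (λ v → (toℕ u <ᵇ toℕ v) ∧ (T u v xor T' u v)))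

_·n²_ : ℚ → ℕ → ℚ
δ ·n² n = δ *ℚ ((+ (n * n)) / 1)

FarFromTransitive : ℚ → ∀ {n} → Adj n → Set
FarFromTransitive δ {n} T =
  ∀ (T' : Adj n) → IsTournament T' → IsTransitive T' → δ ·n² n ≤ ((+ differ T T') / 1)

module Submission where

-- Lemma 2.4.  Reading σ as a transitive tournament, T differs from it exactly
-- on the backward edges, so there are B ≥ α n² of them (OrderTournament).
-- Window surgery: reordering a window W of consecutive positions according to
-- a transitive T' on W turns the backward edges inside W into the
-- disagreements of T[W] with T' and leaves all other pairs alone, so
-- minimality of σ gives backward₀ T[W] ≤ differ T[W] T' (WindowSurgery).
-- For n ≥ 51, 33 windows of length m = ⌈n/20⌉ cover every backward edge of
-- length < n/50 (IntervalCover, ShortEdgeCover), whence B ≤ L + Σₖ backward₀ T[Wₖ]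
-- with L the long backward edges.  If some window holds 6α m² backward edges
-- it is 6α-far from transitive; otherwise the windows hold at most
-- 198 α m² ≤ 0.99 α n², so L ≥ α n²/100 (Dichotomy; n ≤ 50 is trivial).
-- The counting is done in ℕ with α = a/D cross-multiplied; RationalBounds
-- translates to and from the rationals of the statement.

import Data.Nat as ℕ
import Relation.Binary.PropositionalEquality as PE

module FinSums where

  open import Defs
  open import Data.Nat using (ℕ; zero; suc; _+_; _*_; _≤_; z≤n)
  open import Data.Nat.Properties
  open import Data.Fin using (Fin)
  import Data.Fin as F
  open import Data.Bool using (Bool; true; false)
  open import Data.Fin.Permutation using (Permutation′; _⟨$⟩ʳ_)
  open import Relation.Binary.PropositionalEquality
  import Algebra.Properties.CommutativeMonoid.Sum as MonoidSum

  private module Σℕ = MonoidSum +-0-commutativeMonoid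

  ind : Bool → ℕ
  ind true  = 1
  ind false = 0

  count≡sum : ∀ {n} (f : Fin n → Bool) → count f ≡ sumFin (λ i → ind (f i))
  count≡sum {zero}  f = refl
  count≡sum {suc n} f with f F.zero
  ... | true  = cong suc (count≡sum (λ i → f (F.suc i)))
  ... | false = count≡sum (λ i → f (F.suc i))

  sumFin≡sum : ∀ {n} (f : Fin n → ℕ) → sumFin f ≡ Σℕ.sum f
  sumFin≡sum {zero}  f = refl
  sumFin≡sum {suc n} f = cong (f F.zero +_) (sumFin≡sum (λ i → f (F.suc i)))

  sum-cong : ∀ {n} {f g : Fin n → ℕ} → (∀ i → f i ≡ g i) → sumFin f ≡ sumFin g
  sum-cong {zero}  h = refl
  sum-cong {suc n} h = cong₂ _+_ (h F.zero) (sum-cong (λ i → h (F.suc i)))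

  sum-mono : ∀ {n} {f g : Fin n → ℕ} → (∀ i → f i ≤ g i) → sumFin f ≤ sumFin g
  sum-mono {zero}  h = z≤n
  sum-mono {suc n} h = +-mono-≤ (h F.zero) (sum-mono (λ i → h (F.suc i)))

  sum-zero : ∀ {n} → sumFin {n} (λ _ → 0) ≡ 0
  sum-zero {zero}  = refl
  sum-zero {suc n} = sum-zero {n}

  sum-+ : ∀ {n} (f g : Fin n → ℕ) → sumFin (λ i → f i + g i) ≡ sumFin f + sumFin g
  sum-+ f g = begin
    sumFin (λ i → f i + g i)   ≡⟨ sumFin≡sum (λ i → f i + g i) ⟩
    Σℕ.sum (λ i → f i + g i)   ≡⟨ Σℕ.∑-distrib-+ f g ⟩
    Σℕ.sum f + Σℕ.sum g        ≡⟨ sym (cong₂ _+_ (sumFin≡sum f) (sumFin≡sum g)) ⟩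
    sumFin f + sumFin g        ∎
    where open ≡-Reasoning

  sum-comm : ∀ {m n} (f : Fin m → Fin n → ℕ) →
    sumFin (λ i → sumFin (λ j → f i j)) ≡ sumFin (λ j → sumFin (λ i → f i j))
  sum-comm f = begin
    sumFin (λ i → sumFin (λ j → f i j)) ≡⟨ trans (sum-cong (λ i → sumFin≡sum (f i))) (sumFin≡sum (λ i → Σℕ.sum (f i))) ⟩
    Σℕ.sum (λ i → Σℕ.sum (λ j → f i j)) ≡⟨ Σℕ.∑-comm f ⟩
    Σℕ.sum (λ j → Σℕ.sum (λ i → f i j)) ≡⟨ sym (trans (sum-cong (λ j → sumFin≡sum (λ i → f i j))) (sumFin≡sum (λ j → Σℕ.sum (λ i → f i j)))) ⟩
    sumFin (λ j → sumFin (λ i → f i j)) ∎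
    where open ≡-Reasoning

  sum-permute : ∀ {n} (f : Fin n → ℕ) (π : Permutation′ n) → sumFin f ≡ sumFin (λ i → f (π ⟨$⟩ʳ i))
  sum-permute f π = trans (sumFin≡sum f) (trans (Σℕ.∑-permute f π) (sym (sumFin≡sum (λ i → f (π ⟨$⟩ʳ i)))))

  sum-*ʳ : ∀ {n} (f : Fin n → ℕ) c → sumFin f * c ≡ sumFin (λ i → f i * c)
  sum-*ʳ {zero}  f c = refl
  sum-*ʳ {suc n} f c =
    trans (*-distribʳ-+ c (f F.zero) _) (cong (f F.zero * c +_) (sum-*ʳ (λ i → f (F.suc i)) c))

  sum≤const : ∀ {n} (f : Fin n → ℕ) c → (∀ i → f i ≤ c) → sumFin f ≤ n * c
  sum≤const {zero}  f c h = z≤n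
  sum≤const {suc n} f c h = +-mono-≤ (h F.zero) (sum≤const (λ i → f (F.suc i)) c (λ i → h (F.suc i)))

  term≤sum : ∀ {n} (f : Fin n → ℕ) i → f i ≤ sumFin f
  term≤sum {suc n} f F.zero    = m≤m+n _ _
  term≤sum {suc n} f (F.suc i) = ≤-trans (term≤sum (λ j → f (F.suc j)) i) (m≤n+m _ _)


module Comparisons where

  open import Data.Nat using (zero; suc; _+_; _≤_; _<_; _<ᵇ_; _≤ᵇ_)
  open import Data.Nat.Properties
  open import Data.Bool using (Bool; true; false; T; _∧_)
  open import Data.Empty using (⊥-elim)
  open import Relation.Binary.PropositionalEquality

  <ᵇ-true : ∀ {x y} → x < y → (x <ᵇ y) ≡ true
  <ᵇ-true {x} {y} x<y with x <ᵇ y | <⇒<ᵇ x<y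
  ... | true | _ = refl

  <ᵇ-true⇒< : ∀ {x y} → (x <ᵇ y) ≡ true → x < y
  <ᵇ-true⇒< {x} {y} eq = <ᵇ⇒< x y (subst T (sym eq) _)

  <ᵇ-false⇒≥ : ∀ {x y} → (x <ᵇ y) ≡ false → y ≤ x
  <ᵇ-false⇒≥ eq = ≮⇒≥ (λ x<y → subst T eq (<⇒<ᵇ x<y))

  <ᵇ-false : ∀ {x y} → y ≤ x → (x <ᵇ y) ≡ false
  <ᵇ-false {x} {y} y≤x with x <ᵇ y in eq
  ... | false = refl
  ... | true  = ⊥-elim (<⇒≱ (<ᵇ-true⇒< eq) y≤x)

  ≤ᵇ-true : ∀ {x y} → x ≤ y → (x ≤ᵇ y) ≡ true
  ≤ᵇ-true {x} {y} x≤y with x ≤ᵇ y | ≤⇒≤ᵇ x≤y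
  ... | true | _ = refl

  ≤ᵇ-false⇒> : ∀ {x y} → (x ≤ᵇ y) ≡ false → y < x
  ≤ᵇ-false⇒> eq = ≰⇒> (λ x≤y → subst T eq (≤⇒≤ᵇ x≤y))

  ∧-trueˡ : ∀ {x y} → x ∧ y ≡ true → x ≡ true
  ∧-trueˡ {true} _ = refl

  +-<ᵇ : ∀ a x y → (a + x <ᵇ a + y) ≡ (x <ᵇ y)
  +-<ᵇ zero    x y = refl
  +-<ᵇ (suc a) x y = +-<ᵇ a x y


module RankCount where

  open import Defs
  open FinSums
  open Comparisons
  open import Data.Nat using (ℕ; zero; suc; _+_; _<_; _<ᵇ_)
  open import Data.Nat.Properties
  open import Data.Fin using (Fin; toℕ)
  import Data.Fin as F
  import Data.Fin.Properties as FP
  open import Data.Bool using (Bool; true; false; _∧_; not; _xor_)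
  open import Data.Product using (proj₂)
  open import Data.Empty using (⊥-elim)
  open import Relation.Nullary using (yes; no)
  open import Relation.Binary using (tri<; tri≈; tri>)
  open import Relation.Binary.PropositionalEquality

  double-injective : ∀ x y → x + x ≡ y + y → x ≡ y
  double-injective zero    zero    eq = refl
  double-injective zero    (suc y) ()
  double-injective (suc x) zero    ()
  double-injective (suc x) (suc y) eq = cong suc (double-injective x y
    (suc-injective (trans (sym (+-suc x x)) (trans (suc-injective eq) (+-suc y y)))))

  sum-symmetrise : ∀ {n} (G : Fin n → Fin n → ℕ) →
    sumFin (λ u → sumFin (G u)) + sumFin (λ u → sumFin (G u))
      ≡ sumFin (λ u → sumFin (λ v → G u v + G v u))
  sum-symmetrise G = begin
    ΣG + ΣG                                                ≡⟨ cong (ΣG +_) (sum-comm G) ⟩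
    ΣG + sumFin (λ v → sumFin (λ u → G u v))               ≡⟨ sym (sum-+ (λ u → sumFin (G u)) _) ⟩
    sumFin (λ u → sumFin (G u) + sumFin (λ v → G v u))     ≡⟨ sum-cong (λ u → sym (sum-+ (G u) (λ v → G v u))) ⟩
    sumFin (λ u → sumFin (λ v → G u v + G v u))            ∎
    where
    open ≡-Reasoning
    ΣG = sumFin (λ u → sumFin (G u))

  xor-opposite : ∀ x y z → x ≡ not y → z ≡ true → ind (x xor z) + 0 ≡ ind y
  xor-opposite x true  z refl refl = refl
  xor-opposite x false z refl refl = refl

  xor-false : ∀ y z → z ≡ false → ind (y xor z) ≡ ind y
  xor-false true  z refl = refl
  xor-false false z refl = refl

  module _ {n} (A B : Adj n) (tA : IsTournament A) (tB : IsTournament B)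
    (r : Fin n → ℕ) (r-injective : ∀ u v → r u ≡ r v → u ≡ v)
    (B-respects-r : ∀ u v → B u v ≡ true → r u < r v) where

    disagree : Fin n → Fin n → ℕ
    disagree u v = ind ((toℕ u <ᵇ toℕ v) ∧ (A u v xor B u v))

    against : Fin n → Fin n → ℕ
    against u v = ind ((r v <ᵇ r u) ∧ A u v)

    B-against-false : ∀ u v → r u < r v → B v u ≡ false
    B-against-false u v ru<rv with B v u in eq
    ... | false = refl
    ... | true  = ⊥-elim (<⇒≱ (B-respects-r v u eq) (<⇒≤ ru<rv))

    pair-ranked : ∀ u v → u ≢ v → r u < r v →
      disagree u v + disagree v u ≡ against u v + against v u
    pair-ranked u v u≢v ru<rv with <-cmp (toℕ u) (toℕ v)
    ... | tri< u<v _ _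
      rewrite <ᵇ-true u<v | <ᵇ-false (<⇒≤ u<v) | <ᵇ-true ru<rv | <ᵇ-false (<⇒≤ ru<rv)
      = xor-opposite (A u v) (A v u) (B u v) (proj₂ tA u v u≢v)
          (trans (proj₂ tB u v u≢v) (cong not (B-against-false u v ru<rv)))
    ... | tri≈ _ eq _ = ⊥-elim (u≢v (FP.toℕ-injective eq))
    ... | tri> _ _ v<u
      rewrite <ᵇ-true v<u | <ᵇ-false (<⇒≤ v<u) | <ᵇ-true ru<rv | <ᵇ-false (<⇒≤ ru<rv)
      = xor-false (A v u) (B v u) (B-against-false u v ru<rv)

    pair : ∀ u v → disagree u v + disagree v u ≡ against u v + against v u
    pair u v with u F.≟ v
    ... | yes refl rewrite <ᵇ-false (≤-refl {toℕ u}) | <ᵇ-false (≤-refl {r u}) = refl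
    ... | no u≢v with <-cmp (r u) (r v)
    ...   | tri< ru<rv _ _ = pair-ranked u v u≢v ru<rv
    ...   | tri≈ _ eq _    = ⊥-elim (u≢v (r-injective u v eq))
    ...   | tri> _ _ rv<ru = trans (+-comm (disagree u v) _)
                               (trans (pair-ranked v u (≢-sym u≢v) rv<ru) (+-comm (against v u) _))

    -- summing over all pairs and halving
    differ≡against : differ A B ≡ sumFin (λ u → count (λ v → (r v <ᵇ r u) ∧ A u v))
    differ≡against = begin
      differ A B                                  ≡⟨ sum-cong (λ u → count≡sum (λ v → (toℕ u <ᵇ toℕ v) ∧ (A u v xor B u v))) ⟩
      sumFin (λ u → sumFin (disagree u))          ≡⟨ double-injective _ _ symmetrised ⟩
      sumFin (λ u → sumFin (against u))           ≡⟨ sym (sum-cong (λ u → count≡sum (λ v → (r v <ᵇ r u) ∧ A u v))) ⟩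
      sumFin (λ u → count (λ v → (r v <ᵇ r u) ∧ A u v)) ∎
      where
      open ≡-Reasoning
      symmetrised : sumFin (λ u → sumFin (disagree u)) + sumFin (λ u → sumFin (disagree u))
                  ≡ sumFin (λ u → sumFin (against u)) + sumFin (λ u → sumFin (against u))
      symmetrised = trans (sum-symmetrise disagree)
        (trans (sum-cong (λ u → sum-cong (pair u))) (sym (sum-symmetrise against)))


module OrderTournament where

  open import Defs
  open FinSums
  open Comparisons
  open RankCount using (differ≡against)
  open import Data.Nat using (ℕ; _<_; _<ᵇ_)
  open import Data.Nat.Properties using (<-cmp; <⇒≤; ≤-refl)
  open import Data.Fin using (Fin; toℕ)
  import Data.Fin.Properties as FP
  open import Data.Fin.Permutation using (_⟨$⟩ʳ_; _⟨$⟩ˡ_; inverseˡ; inverseʳ)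
  open import Data.Bool using (Bool; _∧_; not)
  open import Data.Product using (_,_)
  open import Data.Empty using (⊥-elim)
  open import Relation.Binary using (tri<; tri≈; tri>)
  open import Relation.Binary.PropositionalEquality

  module _ {n} (σ : Ordering n) where

    rank : Fin n → ℕ
    rank u = toℕ (σ ⟨$⟩ˡ u)

    rank-injective : ∀ u v → rank u ≡ rank v → u ≡ v
    rank-injective u v eq =
      trans (sym (inverseʳ σ)) (trans (cong (σ ⟨$⟩ʳ_) (FP.toℕ-injective eq)) (inverseʳ σ))

    orderTournament : Adj n
    orderTournament u v = rank u <ᵇ rank v

    orderTournament-isTournament : IsTournament orderTournament
    orderTournament-isTournament = (λ u → <ᵇ-false (≤-refl {rank u})) , antisymmetric
      where
      antisymmetric : ∀ u v → u ≢ v → orderTournament u v ≡ not (orderTournament v u)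
      antisymmetric u v u≢v with <-cmp (rank u) (rank v)
      ... | tri< lt _ _ = trans (<ᵇ-true lt) (cong not (sym (<ᵇ-false (<⇒≤ lt))))
      ... | tri≈ _ eq _ = ⊥-elim (u≢v (rank-injective u v eq))
      ... | tri> _ _ gt = trans (<ᵇ-false (<⇒≤ gt)) (cong not (sym (<ᵇ-true gt)))

    orderTournament-isTransitive : IsTransitive orderTournament
    orderTournament-isTransitive =
      σ , λ p q eq → subst₂ _<_ (cong toℕ (inverseˡ σ)) (cong toℕ (inverseˡ σ)) (<ᵇ-true⇒< eq)

    differ≡backward : (T : Adj n) → IsTournament T → differ T orderTournament ≡ backward T σ
    differ≡backward T tT = begin
      differ T orderTournament
        ≡⟨ differ≡against T orderTournament tT orderTournament-isTournament rank rank-injective (λ u v → <ᵇ-true⇒<) ⟩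
      sumFin (λ u → count (against u))
        ≡⟨ sum-permute (λ u → count (against u)) σ ⟩
      sumFin (λ p → count (against (σ ⟨$⟩ʳ p)))
        ≡⟨ sum-cong (λ p → trans (count≡sum (against (σ ⟨$⟩ʳ p))) (sum-permute (λ v → ind (against (σ ⟨$⟩ʳ p) v)) σ)) ⟩
      sumFin (λ p → sumFin (λ q → ind (against (σ ⟨$⟩ʳ p) (σ ⟨$⟩ʳ q))))
        ≡⟨ sum-cong (λ p → sum-cong (λ q → cong₂ (λ x y → ind ((toℕ x <ᵇ toℕ y) ∧ T (σ ⟨$⟩ʳ p) (σ ⟨$⟩ʳ q)))
             (inverseˡ σ) (inverseˡ σ))) ⟩
      sumFin (λ p → sumFin (λ q → ind (IsBackward T σ p q)))
        ≡⟨ sym (sum-cong (λ p → count≡sum (IsBackward T σ p))) ⟩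
      backward T σ ∎
      where
      open ≡-Reasoning
      against : Fin n → Fin n → Bool
      against u v = (rank v <ᵇ rank u) ∧ T u v


module Windows where

  open import Defs
  open FinSums
  open Comparisons
  open import Data.Nat as ℕ using (ℕ; zero; suc; _+_; _∸_; _≤_; _<_; _<ᵇ_)
  open import Data.Nat.Properties
  open import Data.Fin using (Fin; toℕ; fromℕ<)
  import Data.Fin as F
  import Data.Fin.Properties as FP
  open import Data.Bool using (Bool; true; false; if_then_else_; _∧_; not)
  open import Data.Product using (_×_; _,_; proj₁; proj₂)
  open import Data.Sum using (_⊎_; inj₁; inj₂)
  open import Relation.Binary.PropositionalEquality

  inWindow : ℕ → ℕ → ℕ → Bool
  inWindow a m x = not (x <ᵇ a) ∧ (x <ᵇ a + m)

  inWindow-intro : ∀ a m x → a ≤ x → x < a + m → inWindow a m x ≡ true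
  inWindow-intro a m x a≤x x<a+m rewrite <ᵇ-false {x} {a} a≤x | <ᵇ-true x<a+m = refl

  inWindow⇒ : ∀ a m x → inWindow a m x ≡ true → a ≤ x × x < a + m
  inWindow⇒ a m x eq with x <ᵇ a in e₁ | x <ᵇ a + m in e₂
  inWindow⇒ a m x ()  | true  | _
  inWindow⇒ a m x refl | false | true = <ᵇ-false⇒≥ e₁ , <ᵇ-true⇒< e₂

  outWindow⇒ : ∀ a m x → inWindow a m x ≡ false → x < a ⊎ a + m ≤ x
  outWindow⇒ a m x eq with x <ᵇ a in e₁ | x <ᵇ a + m in e₂
  outWindow⇒ a m x eq   | true  | _     = inj₁ (<ᵇ-true⇒< e₁)
  outWindow⇒ a m x refl | false | false = inj₂ (<ᵇ-false⇒≥ e₂)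

  outside-<ᵇ-inside : ∀ a m x y z → inWindow a m x ≡ true → inWindow a m y ≡ true →
    inWindow a m z ≡ false → (z <ᵇ x) ≡ (z <ᵇ y)
  outside-<ᵇ-inside a m x y z ex ey ez with inWindow⇒ a m x ex | inWindow⇒ a m y ey | outWindow⇒ a m z ez
  ... | a≤x , _ | a≤y , _ | inj₁ z<a =
    trans (<ᵇ-true (<-≤-trans z<a a≤x)) (sym (<ᵇ-true (<-≤-trans z<a a≤y)))
  ... | _ , x<e | _ , y<e | inj₂ e≤z =
    trans (<ᵇ-false (≤-trans (<⇒≤ x<e) e≤z)) (sym (<ᵇ-false (≤-trans (<⇒≤ y<e) e≤z)))

  inside-<ᵇ-outside : ∀ a m x y z → inWindow a m x ≡ true → inWindow a m y ≡ true →
    inWindow a m z ≡ false → (x <ᵇ z) ≡ (y <ᵇ z)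
  inside-<ᵇ-outside a m x y z ex ey ez with inWindow⇒ a m x ex | inWindow⇒ a m y ey | outWindow⇒ a m z ez
  ... | a≤x , _ | a≤y , _ | inj₁ z<a =
    trans (<ᵇ-false (≤-trans (<⇒≤ z<a) a≤x)) (sym (<ᵇ-false (≤-trans (<⇒≤ z<a) a≤y)))
  ... | _ , x<e | _ , y<e | inj₂ e≤z =
    trans (<ᵇ-true (<-≤-trans x<e e≤z)) (sym (<ᵇ-true (<-≤-trans y<e e≤z)))

  module Window {n : ℕ} (a m : ℕ) (fits : a + m ≤ n) where

    embed : Fin m → Fin n
    embed i = fromℕ< (≤-trans (+-monoʳ-< a (FP.toℕ<n i)) fits)

    toℕ-embed : ∀ i → toℕ (embed i) ≡ a + toℕ i
    toℕ-embed i = FP.toℕ-fromℕ< _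

    inside : Fin n → Bool
    inside p = inWindow a m (toℕ p)

    embed-inside : ∀ i → inside (embed i) ≡ true
    embed-inside i rewrite toℕ-embed i = inWindow-intro a m (a + toℕ i) (m≤m+n a _) (+-monoʳ-< a (FP.toℕ<n i))

    offset : ∀ p → inside p ≡ true → Fin m
    offset p inW = fromℕ< (+-cancelˡ-< a (toℕ p ∸ a) m (subst (_< a + m) (sym (m+[n∸m]≡n a≤p)) p<a+m))
      where
      a≤p = proj₁ (inWindow⇒ a m (toℕ p) inW)
      p<a+m = proj₂ (inWindow⇒ a m (toℕ p) inW)

    embed-offset : ∀ p inW → embed (offset p inW) ≡ p
    embed-offset p inW = FP.toℕ-injective (begin
      toℕ (embed (offset p inW)) ≡⟨ toℕ-embed _ ⟩
      a + toℕ (offset p inW)     ≡⟨ cong (a +_) (FP.toℕ-fromℕ< _) ⟩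
      a + (toℕ p ∸ a)            ≡⟨ m+[n∸m]≡n (proj₁ (inWindow⇒ a m (toℕ p) inW)) ⟩
      toℕ p                      ∎)
      where open ≡-Reasoning

    offset-embed : ∀ i inW → offset (embed i) inW ≡ i
    offset-embed i inW = FP.toℕ-injective (begin
      toℕ (offset (embed i) inW) ≡⟨ FP.toℕ-fromℕ< _ ⟩
      toℕ (embed i) ∸ a          ≡⟨ cong (_∸ a) (toℕ-embed i) ⟩
      a + toℕ i ∸ a              ≡⟨ m+n∸m≡n a (toℕ i) ⟩
      toℕ i                      ∎)
      where open ≡-Reasoning

    -- g acting on the window, identity elsewhere; the auxiliary argument
    -- remembers the outcome of the membership test
    extendAt : (Fin m → Fin m) → (p : Fin n) → (b : Bool) → inside p ≡ b → Fin n
    extendAt g p true  inW = embed (g (offset p inW))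
    extendAt g p false _   = p

    extend : (Fin m → Fin m) → Fin n → Fin n
    extend g p = extendAt g p (inside p) refl

    extend-outside : ∀ g p → inside p ≡ false → extend g p ≡ p
    extend-outside g p out = go (inside p) refl
      where
      go : ∀ b (eq : inside p ≡ b) → extendAt g p b eq ≡ p
      go true  eq with () ← trans (sym eq) out
      go false eq = refl

    extend-inside : ∀ g p (inW : inside p ≡ true) → extend g p ≡ embed (g (offset p inW))
    extend-inside g p inW = go (inside p) refl
      where
      go : ∀ b (eq : inside p ≡ b) → extendAt g p b eq ≡ embed (g (offset p inW))
      go true  eq = refl
      go false eq with () ← trans (sym eq) inW

    extend-embed : ∀ g i → extend g (embed i) ≡ embed (g i)
    extend-embed g i = trans (extend-inside g (embed i) (embed-inside i))
                             (cong (λ j → embed (g j)) (offset-embed i (embed-inside i)))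

    extend-preserves-inside : ∀ g p → inside p ≡ true → inside (extend g p) ≡ true
    extend-preserves-inside g p inW = trans (cong inside (extend-inside g p inW)) (embed-inside _)

    extend-inverse : ∀ g h → (∀ i → g (h i) ≡ i) → ∀ p → extend g (extend h p) ≡ p
    extend-inverse g h inverse p = go (inside p) refl
      where
      open ≡-Reasoning
      go : ∀ b → inside p ≡ b → extend g (extend h p) ≡ p
      go true inW = begin
        extend g (extend h p)               ≡⟨ cong (extend g) (extend-inside h p inW) ⟩
        extend g (embed (h (offset p inW))) ≡⟨ extend-embed g _ ⟩
        embed (g (h (offset p inW)))        ≡⟨ cong embed (inverse _) ⟩
        embed (offset p inW)                ≡⟨ embed-offset p inW ⟩
        p                                   ∎
      go false out = trans (cong (extend g) (extend-outside h p out)) (extend-outside g p out)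

  sum-window : ∀ n a m (fits : a + m ≤ n) (G : Fin n → ℕ) →
    sumFin (λ p → if inWindow a m (toℕ p) then G p else 0) ≡ sumFin (λ i → G (Window.embed a m fits i))
  sum-window zero    zero    zero    fits G = refl
  sum-window (suc n) (suc a) m       fits G =
    trans (sum-window n a m (ℕ.s≤s⁻¹ fits) (λ p → G (F.suc p)))
          (sum-cong (λ i → cong G (FP.toℕ-injective
            (trans (cong suc (Window.toℕ-embed a m (ℕ.s≤s⁻¹ fits) i)) (sym (Window.toℕ-embed (suc a) m fits i))))))
  sum-window (suc n) zero    zero    fits G = sum-zero {suc n}
  sum-window (suc n) zero    (suc m) fits G =
    cong₂ _+_ (cong G (FP.toℕ-injective (sym (Window.toℕ-embed zero (suc m) fits F.zero))))
      (trans (sum-window n zero m (ℕ.s≤s⁻¹ fits) (λ p → G (F.suc p)))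
        (sum-cong (λ i → cong G (FP.toℕ-injective
          (trans (cong suc (Window.toℕ-embed zero m (ℕ.s≤s⁻¹ fits) i)) (sym (Window.toℕ-embed zero (suc m) fits (F.suc i))))))))


-- For a window W of positions of a minimal ordering σ, the
-- subtournament T[W] (in σ-order) has at most as many backward edges as it has
-- disagreements with any transitive tournament T' on W: otherwise reordering
-- W according to T' would give an ordering with fewer backward edges.
module WindowSurgery where

  open import Defs
  open FinSums
  open Comparisons
  open RankCount using (differ≡against)
  open OrderTournament using (rank; rank-injective)
  open Windows
  open import Data.Nat using (ℕ; _+_; _≤_; _<_; _<ᵇ_)
  open import Data.Nat.Properties
  open import Data.Fin using (Fin; toℕ)
  import Data.Fin.Properties as FP
  open import Data.Fin.Permutation using (_⟨$⟩ʳ_; _⟨$⟩ˡ_; permutation; inverseˡ; inverseʳ)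
  open import Data.Bool using (Bool; true; false; if_then_else_; _∧_)
  open import Data.Product using (_,_; proj₁; proj₂)
  open import Relation.Binary.PropositionalEquality

  backward₀ : ∀ {m} → Adj m → ℕ
  backward₀ T = sumFin (λ i → count (λ j → (toℕ j <ᵇ toℕ i) ∧ T i j))

  induced : ∀ {m n} → Adj n → (Fin m → Fin n) → Adj m
  induced T e i j = T (e i) (e j)

  induced-isTournament : ∀ {m n} (T : Adj n) (e : Fin m → Fin n) →
    (∀ i j → e i ≡ e j → i ≡ j) → IsTournament T → IsTournament (induced T e)
  induced-isTournament T e e-inj (loopless , oriented) =
    (λ i → loopless (e i)) , (λ i j i≢j → oriented (e i) (e j) (λ eq → i≢j (e-inj i j eq)))

  if-sum : ∀ {n} b (X : Fin n → ℕ) → sumFin (λ q → if b then X q else 0) ≡ (if b then sumFin X else 0)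
  if-sum     true  X = refl
  if-sum {n} false X = sum-zero {n}

  module _ {n : ℕ} (a m : ℕ) (fits : a + m ≤ n) where
    open Window a m fits

    insidePairs otherPairs : (Fin n → Fin n → ℕ) → ℕ
    insidePairs F = sumFin (λ p → sumFin (λ q → if inside p then (if inside q then F p q else 0) else 0))
    otherPairs  F = sumFin (λ p → sumFin (λ q → if inside p ∧ inside q then 0 else F p q))

    split : ∀ F → sumFin (λ p → sumFin (F p)) ≡ insidePairs F + otherPairs F
    split F = trans (sum-cong (λ p → trans (sum-cong (λ q → split-pair (inside p) (inside q) (F p q)))
                                            (sum-+ (insideAt p) (otherAt p))))
                    (sum-+ (λ p → sumFin (insideAt p)) (λ p → sumFin (otherAt p)))
      where
      insideAt otherAt : Fin n → Fin n → ℕ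
      insideAt p q = if inside p then (if inside q then F p q else 0) else 0
      otherAt  p q = if inside p ∧ inside q then 0 else F p q
      split-pair : ∀ (x y : Bool) v → v ≡ (if x then (if y then v else 0) else 0) + (if x ∧ y then 0 else v)
      split-pair true  true  v = sym (+-identityʳ v)
      split-pair true  false v = refl
      split-pair false y     v = refl

    insidePairs-window : ∀ F → insidePairs F ≡ sumFin (λ i → sumFin (λ j → F (embed i) (embed j)))
    insidePairs-window F = begin
      insidePairs F
        ≡⟨ sum-cong (λ p → if-sum (inside p) (λ q → if inside q then F p q else 0)) ⟩
      sumFin (λ p → if inside p then sumFin (λ q → if inside q then F p q else 0) else 0)
        ≡⟨ sum-window n a m fits (λ p → sumFin (λ q → if inside q then F p q else 0)) ⟩
      sumFin (λ i → sumFin (λ q → if inside q then F (embed i) q else 0))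
        ≡⟨ sum-cong (λ i → sum-window n a m fits (F (embed i))) ⟩
      sumFin (λ i → sumFin (λ j → F (embed i) (embed j))) ∎
      where open ≡-Reasoning

    otherPairs-cong : ∀ F G → (∀ p q → inside p ∧ inside q ≡ false → F p q ≡ G p q) →
      otherPairs F ≡ otherPairs G
    otherPairs-cong F G agree = sum-cong (λ p → sum-cong (λ q → go (inside p ∧ inside q) refl))
      where
      go : ∀ {p q} b → inside p ∧ inside q ≡ b → (if b then 0 else F p q) ≡ (if b then 0 else G p q)
      go true  _  = refl
      go false eq = agree _ _ eq

  module _ {n : ℕ} (T : Adj n) (tT : IsTournament T) (σ : Ordering n) (σ-minimal : IsMinimalOrdering T σ)
           (a m : ℕ) (fits : a + m ≤ n) where
    open Window a m fits

    windowVertex : Fin m → Fin n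
    windowVertex i = σ ⟨$⟩ʳ embed i

    windowVertex-injective : ∀ i j → windowVertex i ≡ windowVertex j → i ≡ j
    windowVertex-injective i j eq = FP.toℕ-injective (+-cancelˡ-≡ a (toℕ i) (toℕ j)
      (trans (sym (toℕ-embed i)) (trans (cong toℕ embed-eq) (toℕ-embed j))))
      where
      embed-eq : embed i ≡ embed j
      embed-eq = trans (sym (inverseˡ σ)) (trans (cong (σ ⟨$⟩ˡ_) eq) (inverseˡ σ))

    T[W] : Adj m
    T[W] = induced T windowVertex

    backwardAfter : (Fin n → Fin n) → Fin n → Fin n → ℕ
    backwardAfter π p q = ind ((toℕ (π q) <ᵇ toℕ (π p)) ∧ T (σ ⟨$⟩ʳ p) (σ ⟨$⟩ʳ q))

    backward-pairs : backward T σ ≡ sumFin (λ p → sumFin (backwardAfter (λ p → p) p))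
    backward-pairs = sum-cong (λ p → count≡sum (IsBackward T σ p))

    inside-backward : insidePairs a m fits (backwardAfter (λ p → p)) ≡ backward₀ T[W]
    inside-backward = trans (insidePairs-window a m fits _) (sum-cong (λ i → trans
      (sum-cong (λ j → cong (λ c → ind (c ∧ T[W] i j))
        (trans (cong₂ _<ᵇ_ (toℕ-embed j) (toℕ-embed i)) (+-<ᵇ a (toℕ j) (toℕ i)))))
      (sym (count≡sum (λ j → (toℕ j <ᵇ toℕ i) ∧ T[W] i j)))))

    module Reorder (T' : Adj m) (tT' : IsTournament T') (trT' : IsTransitive T') where

      τ : Ordering m
      τ = proj₁ trT'

      φ ψ : Fin n → Fin n
      φ = extend (τ ⟨$⟩ʳ_)
      ψ = extend (τ ⟨$⟩ˡ_)

      φψ : ∀ p → φ (ψ p) ≡ p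
      φψ = extend-inverse (τ ⟨$⟩ʳ_) (τ ⟨$⟩ˡ_) (λ i → inverseʳ τ)

      ψφ : ∀ p → ψ (φ p) ≡ p
      ψφ = extend-inverse (τ ⟨$⟩ˡ_) (τ ⟨$⟩ʳ_) (λ i → inverseˡ τ)

      σ′ : Ordering n
      σ′ = permutation (λ p → σ ⟨$⟩ʳ φ p) (λ u → ψ (σ ⟨$⟩ˡ u))
             (λ u → trans (cong (σ ⟨$⟩ʳ_) (φψ (σ ⟨$⟩ˡ u))) (inverseʳ σ))
             (λ p → trans (cong ψ (inverseˡ σ)) (ψφ p))

      backward-σ′ : backward T σ′ ≡ sumFin (λ p → sumFin (backwardAfter ψ p))
      backward-σ′ = begin
        backward T σ′
          ≡⟨ sum-cong (λ p → count≡sum (IsBackward T σ′ p)) ⟩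
        sumFin (λ p → sumFin (G p))
          ≡⟨ sum-permute (λ p → sumFin (G p)) ρ ⟩
        sumFin (λ p → sumFin (G (ψ p)))
          ≡⟨ sum-cong (λ p → sum-permute (G (ψ p)) ρ) ⟩
        sumFin (λ p → sumFin (λ q → G (ψ p) (ψ q)))
          ≡⟨ sum-cong (λ p → sum-cong (λ q → cong₂ (λ x y → ind ((toℕ (ψ q) <ᵇ toℕ (ψ p)) ∧ T (σ ⟨$⟩ʳ x) (σ ⟨$⟩ʳ y)))
               (φψ p) (φψ q))) ⟩
        sumFin (λ p → sumFin (backwardAfter ψ p)) ∎
        where
        open ≡-Reasoning
        ρ : Ordering n
        ρ = permutation ψ φ ψφ φψ
        G : Fin n → Fin n → ℕ
        G p q = ind ((toℕ q <ᵇ toℕ p) ∧ T (σ ⟨$⟩ʳ φ p) (σ ⟨$⟩ʳ φ q))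

      inside-reordered : insidePairs a m fits (backwardAfter ψ) ≡ differ T[W] T'
      inside-reordered = begin
        insidePairs a m fits (backwardAfter ψ)
          ≡⟨ insidePairs-window a m fits _ ⟩
        sumFin (λ i → sumFin (λ j → backwardAfter ψ (embed i) (embed j)))
          ≡⟨ sum-cong (λ i → trans (sum-cong (λ j → cong (λ c → ind (c ∧ T[W] i j)) (relabel i j)))
                                   (sym (count≡sum (λ j → (r j <ᵇ r i) ∧ T[W] i j)))) ⟩
        sumFin (λ i → count (λ j → (r j <ᵇ r i) ∧ T[W] i j))
          ≡⟨ sym (differ≡against T[W] T' tT[W] tT' r (rank-injective τ) T'-respects-r) ⟩
        differ T[W] T' ∎
        where
        open ≡-Reasoning
        tT[W] = induced-isTournament T windowVertex windowVertex-injective tT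
        r = rank τ
        T'-respects-r : ∀ i j → T' i j ≡ true → r i < r j
        T'-respects-r i j eq = proj₂ trT' (τ ⟨$⟩ˡ i) (τ ⟨$⟩ˡ j) (trans (cong₂ T' (inverseʳ τ) (inverseʳ τ)) eq)
        relabel : ∀ i j → (toℕ (ψ (embed j)) <ᵇ toℕ (ψ (embed i))) ≡ (r j <ᵇ r i)
        relabel i j = trans (cong₂ (λ x y → toℕ x <ᵇ toℕ y) (extend-embed _ j) (extend-embed _ i))
                            (trans (cong₂ _<ᵇ_ (toℕ-embed _) (toℕ-embed _)) (+-<ᵇ a (r j) (r i)))

      outside-unchanged : otherPairs a m fits (backwardAfter (λ p → p)) ≡ otherPairs a m fits (backwardAfter ψ)
      outside-unchanged = otherPairs-cong a m fits _ _
        (λ p q out → cong (λ c → ind (c ∧ T (σ ⟨$⟩ʳ p) (σ ⟨$⟩ʳ q))) (same-order p q (inside p) (inside q) refl refl out))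
        where
        same-order : ∀ p q x y → inside p ≡ x → inside q ≡ y → x ∧ y ≡ false →
          (toℕ q <ᵇ toℕ p) ≡ (toℕ (ψ q) <ᵇ toℕ (ψ p))
        same-order p q true true  _  _  ()
        same-order p q true false ip oq _ =
          trans (outside-<ᵇ-inside a m (toℕ p) (toℕ (ψ p)) (toℕ q) ip (extend-preserves-inside _ p ip) oq)
                (cong (λ z → toℕ z <ᵇ toℕ (ψ p)) (sym (extend-outside _ q oq)))
        same-order p q false true op iq _ =
          trans (inside-<ᵇ-outside a m (toℕ q) (toℕ (ψ q)) (toℕ p) iq (extend-preserves-inside _ q iq) op)
                (cong (λ z → toℕ (ψ q) <ᵇ toℕ z) (sym (extend-outside _ p op)))
        same-order p q false false op oq _ =
          cong₂ (λ x y → toℕ x <ᵇ toℕ y) (sym (extend-outside _ q oq)) (sym (extend-outside _ p op))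

    window-surgery : ∀ T' → IsTournament T' → IsTransitive T' → backward₀ T[W] ≤ differ T[W] T'
    window-surgery T' tT' trT' = subst₂ _≤_ inside-backward inside-reordered
      (+-cancelʳ-≤ (otherPairs a m fits b) _ _ (subst₂ _≤_ before after (σ-minimal σ′)))
      where
      open Reorder T' tT' trT'
      b = backwardAfter (λ p → p)
      before : backward T σ ≡ insidePairs a m fits b + otherPairs a m fits b
      before = trans backward-pairs (split a m fits b)
      after : backward T σ′ ≡ insidePairs a m fits (backwardAfter ψ) + otherPairs a m fits b
      after = trans backward-σ′ (trans (split a m fits (backwardAfter ψ))
                (cong (insidePairs a m fits (backwardAfter ψ) +_) (sym outside-unchanged)))


-- The windows of
-- length m start at min(k (s + 1), n ∸ m) for k = 0, …, K; if they reach the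
-- end (n ∸ m ≤ K (s + 1)), every interval [x, y] ⊆ [0, n) with
-- (s + 1) + (y ∸ x) ≤ m lies inside one of them: take k = min(⌊x/(s+1)⌋, K).
module IntervalCover where

  open import Data.Nat using (ℕ; suc; _+_; _*_; _∸_; _≤_; _<_; _⊓_; _≤?_)
  open import Data.Nat.Properties
  open import Data.Nat.DivMod using (_/_; _%_; m≡m%n+[m/n]*n; m%n<n; m/n*n≤m)
  open import Data.Product using (∃; _×_; _,_)
  open import Data.Sum using (inj₁; inj₂)
  open import Data.Empty using (⊥-elim)
  open import Relation.Nullary using (yes; no)
  open import Relation.Binary.PropositionalEquality

  module _ (n m s K : ℕ) where

    windowStart : ℕ → ℕ
    windowStart k = (k * suc s) ⊓ (n ∸ m)

    windowStart-fits : m ≤ n → ∀ k → windowStart k + m ≤ n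
    windowStart-fits m≤n k = ≤-trans (+-monoˡ-≤ m (m⊓n≤n (k * suc s) (n ∸ m))) (≤-reflexive (m∸n+n≡m m≤n))

    interval-cover : m ≤ n → n ∸ m ≤ K * suc s → ∀ x y → x ≤ y → y < n → suc s + (y ∸ x) ≤ m →
      ∃ λ k → k ≤ K × windowStart k ≤ x × y < windowStart k + m
    interval-cover m≤n reach x y x≤y y<n short = k , m⊓n≤n _ K , start≤x , y<end
      where
      open ≤-Reasoning
      q = x / suc s
      k = q ⊓ K
      start≤x : windowStart k ≤ x
      start≤x = begin
        windowStart k   ≤⟨ m⊓n≤m (k * suc s) (n ∸ m) ⟩
        k * suc s       ≤⟨ *-monoˡ-≤ (suc s) (m⊓n≤m q K) ⟩
        q * suc s       ≤⟨ m/n*n≤m x (suc s) ⟩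
        x               ∎
      y<end : y < windowStart k + m
      y<end with n ∸ m ≤? k * suc s
      ... | yes capped rewrite m≥n⇒m⊓n≡n capped | m∸n+n≡m m≤n = y<n
      ... | no uncapped rewrite m≤n⇒m⊓n≡m (<⇒≤ (≰⇒> uncapped)) with ≤-total q K
      ...   | inj₂ K≤q rewrite m≥n⇒m⊓n≡n K≤q = ⊥-elim (uncapped reach)
      ...   | inj₁ q≤K rewrite m≤n⇒m⊓n≡m q≤K = begin-strict
        y                                 ≡⟨ sym (m+[n∸m]≡n x≤y) ⟩
        x + (y ∸ x)                       ≡⟨ cong (_+ (y ∸ x)) (m≡m%n+[m/n]*n x (suc s)) ⟩
        x % suc s + q * suc s + (y ∸ x)   <⟨ +-monoˡ-< (y ∸ x) (+-monoˡ-< (q * suc s) (m%n<n x (suc s))) ⟩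
        suc s + q * suc s + (y ∸ x)       ≡⟨ cong (_+ (y ∸ x)) (+-comm (suc s) (q * suc s)) ⟩
        q * suc s + suc s + (y ∸ x)       ≡⟨ +-assoc (q * suc s) (suc s) (y ∸ x) ⟩
        q * suc s + (suc s + (y ∸ x))     ≤⟨ +-monoʳ-≤ (q * suc s) short ⟩
        q * suc s + m                     ∎


module ShortEdgeCover where

  open import Defs
  open FinSums
  open Comparisons
  open Windows using (inWindow-intro; module Window)
  open WindowSurgery
  open IntervalCover
  open import Data.Nat using (ℕ; suc; _+_; _*_; _∸_; _≤_; _<_; _≤ᵇ_; s≤s; z≤n)
  open import Data.Nat.Properties
  open import Data.Fin using (Fin; toℕ; fromℕ<)
  import Data.Fin.Properties as FP
  open import Data.Bool using (Bool; true; false; if_then_else_; _∧_)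
  open import Data.Product using (∃; _,_)
  open import Relation.Binary.PropositionalEquality

  all-long : ∀ {n} (T : Adj n) (σ : Ordering n) (L c : ℕ) → L ≤ c → backward T σ ≤ backwardLong T σ L c
  all-long T σ L c L≤c = subst₂ _≤_
    (sym (sum-cong (λ p → count≡sum (IsBackward T σ p))))
    (sym (sum-cong (λ p → count≡sum (λ q → IsBackward T σ p q ∧ (L ≤ᵇ c * (toℕ p ∸ toℕ q))))))
    (sum-mono (λ p → sum-mono (long p)))
    where
    long : ∀ p q → ind (IsBackward T σ p q) ≤ ind (IsBackward T σ p q ∧ (L ≤ᵇ c * (toℕ p ∸ toℕ q)))
    long p q with IsBackward T σ p q in back
    ... | false = z≤n
    ... | true = subst (λ b → 1 ≤ ind b) (sym (≤ᵇ-true L≤c*length)) (s≤s z≤n)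
      where
      L≤c*length : L ≤ c * (toℕ p ∸ toℕ q)
      L≤c*length = ≤-trans L≤c (≤-trans (≤-reflexive (sym (*-identityʳ c)))
                     (*-monoʳ-≤ c (m<n⇒0<n∸m (<ᵇ-true⇒< {toℕ q} {toℕ p} (∧-trueˡ back)))))

  module Cover {n : ℕ} (T : Adj n) (tT : IsTournament T) (σ : Ordering n) (σ-minimal : IsMinimalOrdering T σ)
           (m s K L c : ℕ) (m≤n : m ≤ n) (reach : n ∸ m ≤ K * suc s)
           (short-fits : ∀ ℓ → c * ℓ < L → suc s + ℓ ≤ m) where

    startOf : Fin (suc K) → ℕ
    startOf k = windowStart n m s K (toℕ k)

    fits : ∀ k → startOf k + m ≤ n
    fits k = windowStart-fits n m s K m≤n (toℕ k)

    windowT : Fin (suc K) → Adj m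
    windowT k = T[W] T tT σ σ-minimal (startOf k) m (fits k)

    isBackward isLong : Fin n → Fin n → ℕ
    isBackward p q = ind (IsBackward T σ p q)
    isLong     p q = ind (IsBackward T σ p q ∧ (L ≤ᵇ c * (toℕ p ∸ toℕ q)))

    inWindowK : Fin (suc K) → Fin n → Fin n → ℕ
    inWindowK k p q = if inside p then (if inside q then isBackward p q else 0) else 0
      where open Window (startOf k) m (fits k)

    short-in-window : ∀ p q → toℕ q < toℕ p → c * (toℕ p ∸ toℕ q) < L →
      ∃ λ k → inWindowK k p q ≡ isBackward p q
    short-in-window p q q<p short
      with interval-cover n m s K m≤n reach (toℕ q) (toℕ p) (<⇒≤ q<p) (FP.toℕ<n p) (short-fits _ short)
    ... | k₀ , k₀≤K , start≤q , p<end =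
      k , both-inside (inside-k p (≤-trans start≤q (<⇒≤ q<p)) p<end) (inside-k q start≤q (<-trans q<p p<end))
      where
      k : Fin (suc K)
      k = fromℕ< (s≤s k₀≤K)
      inside-k : ∀ r → windowStart n m s K k₀ ≤ toℕ r → toℕ r < windowStart n m s K k₀ + m →
        Window.inside (startOf k) m (fits k) r ≡ true
      inside-k r lower upper rewrite FP.toℕ-fromℕ< (s≤s k₀≤K) = inWindow-intro _ m (toℕ r) lower upper
      both-inside : ∀ {x y} → x ≡ true → y ≡ true →
        (if x then (if y then isBackward p q else 0) else 0) ≡ isBackward p q
      both-inside refl refl = refl

    edge-cover : ∀ p q → isBackward p q ≤ isLong p q + sumFin (λ k → inWindowK k p q)
    edge-cover p q = cases (IsBackward T σ p q) refl (L ≤ᵇ c * (toℕ p ∸ toℕ q)) refl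
      where
      cases : ∀ x → IsBackward T σ p q ≡ x → ∀ y → (L ≤ᵇ c * (toℕ p ∸ toℕ q)) ≡ y →
        isBackward p q ≤ isLong p q + sumFin (λ k → inWindowK k p q)
      cases false back _     _    rewrite back = z≤n
      cases true  back true  long rewrite back | long = s≤s z≤n
      cases true  back false long
        with short-in-window p q (<ᵇ-true⇒< (∧-trueˡ back)) (≤ᵇ-false⇒> long)
      ... | k , in-k = ≤-trans (≤-reflexive (sym in-k))
                         (≤-trans (term≤sum (λ k → inWindowK k p q) k) (m≤n+m _ (isLong p q)))

    short-edge-cover : backward T σ ≤ backwardLong T σ L c + sumFin (λ k → backward₀ (windowT k))
    short-edge-cover = begin
      backward T σ
        ≡⟨ sum-cong (λ p → count≡sum (IsBackward T σ p)) ⟩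
      sumFin (λ p → sumFin (isBackward p))
        ≤⟨ sum-mono (λ p → sum-mono (edge-cover p)) ⟩
      sumFin (λ p → sumFin (λ q → isLong p q + sumFin (λ k → inWindowK k p q)))
        ≡⟨ sum-cong (λ p → sum-+ (isLong p) (λ q → sumFin (λ k → inWindowK k p q))) ⟩
      sumFin (λ p → sumFin (isLong p) + sumFin (λ q → sumFin (λ k → inWindowK k p q)))
        ≡⟨ sum-+ (λ p → sumFin (isLong p)) (λ p → sumFin (λ q → sumFin (λ k → inWindowK k p q))) ⟩
      sumFin (λ p → sumFin (isLong p)) + sumFin (λ p → sumFin (λ q → sumFin (λ k → inWindowK k p q)))
        ≡⟨ cong₂ _+_ long-part window-part ⟩
      backwardLong T σ L c + sumFin (λ k → backward₀ (windowT k)) ∎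
      where
      open ≤-Reasoning
      long-part : sumFin (λ p → sumFin (isLong p)) ≡ backwardLong T σ L c
      long-part = sym (sum-cong (λ p → count≡sum (λ q → IsBackward T σ p q ∧ (L ≤ᵇ c * (toℕ p ∸ toℕ q)))))
      window-part : sumFin (λ p → sumFin (λ q → sumFin (λ k → inWindowK k p q)))
                  ≡ sumFin (λ k → backward₀ (windowT k))
      window-part = trans (sum-cong (λ p → sum-comm (λ q k → inWindowK k p q)))
        (trans (sum-comm (λ p k → sumFin (λ q → inWindowK k p q)))
          (sum-cong (λ k → inside-backward T tT σ σ-minimal (startOf k) m (fits k))))


-- Arithmetic of the window parameters, from the inequalities that characterise
-- m = ⌈n/20⌉ and f = ⌊n/50⌋ for n ≥ 51, with step s + 1 = m - f between windows.
module WindowArithmetic (n m f s : ℕ.ℕ) (51≤n : 51 ℕ.≤ n)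
  (m*20≤n+19 : m ℕ.* 20 ℕ.≤ n ℕ.+ 19) (n≤m*20 : n ℕ.≤ m ℕ.* 20)
  (f*50≤n : f ℕ.* 50 ℕ.≤ n) (n<50+f*50 : n ℕ.< 50 ℕ.+ f ℕ.* 50)
  (m≡f+s+1 : m PE.≡ f ℕ.+ ℕ.suc s) where

  open import Data.Nat using (ℕ; suc; _+_; _*_; _∸_; _≤_; _<_; s≤s; z≤n)
  open import Data.Nat.Properties
  open import Data.Nat.Tactic.RingSolver using (solve)
  open import Data.List using (_∷_; [])
  open import Relation.Binary.PropositionalEquality
  open ≤-Reasoning

  m≤n : m ≤ n
  m≤n = *-cancelʳ-≤ m n 20 (≤-trans m*20≤n+19 (begin
    n + 19        ≤⟨ +-monoʳ-≤ n (*-monoˡ-≤ 19 (≤-trans (s≤s z≤n) 51≤n)) ⟩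
    n + n * 19    ≡⟨ solve (n ∷ []) ⟩
    n * 20        ∎))

  -- a short length ℓ (50 ℓ < n) is at most f, so it fits in a window with the step
  short-fits : ∀ ℓ → 50 * ℓ < n → suc s + ℓ ≤ m
  short-fits ℓ short = begin
    suc s + ℓ   ≤⟨ +-monoʳ-≤ (suc s) ℓ≤f ⟩
    suc s + f   ≡⟨ trans (+-comm (suc s) f) (sym m≡f+s+1) ⟩
    m           ∎
    where
    ℓ≤f : ℓ ≤ f
    ℓ≤f = m<1+n⇒m≤n (*-cancelʳ-< 50 ℓ (suc f) (<-trans (subst (_< n) (*-comm 50 ℓ) short) n<50+f*50))

  -- 33 windows reach the end, because n + 32 f ≤ 33 m
  reach : n ∸ m ≤ 32 * suc s
  reach = ≤-trans (∸-monoˡ-≤ m n≤m+32s) (≤-reflexive (m+n∸m≡n m (32 * suc s)))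
    where
    n+32f≤33m : n + 32 * f ≤ 33 * m
    n+32f≤33m = *-cancelˡ-≤ 100 (begin
      100 * (n + 32 * f)          ≡⟨ solve (n ∷ f ∷ []) ⟩
      100 * n + 64 * (f * 50)     ≤⟨ +-monoʳ-≤ (100 * n) (*-monoʳ-≤ 64 f*50≤n) ⟩
      100 * n + 64 * n            ≤⟨ +-monoʳ-≤ (100 * n) (*-monoˡ-≤ n (n≤1+n 64)) ⟩
      100 * n + 65 * n            ≡⟨ solve (n ∷ []) ⟩
      165 * n                     ≤⟨ *-monoʳ-≤ 165 n≤m*20 ⟩
      165 * (m * 20)              ≡⟨ solve (m ∷ []) ⟩
      100 * (33 * m)              ∎)
    n≤m+32s : n ≤ m + 32 * suc s
    n≤m+32s = +-cancelʳ-≤ (32 * f) n (m + 32 * suc s) (begin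
      n + 32 * f                      ≤⟨ n+32f≤33m ⟩
      33 * m                          ≡⟨ cong (33 *_) m≡f+s+1 ⟩
      33 * (f + suc s)                ≡⟨ solve (f ∷ s ∷ []) ⟩
      f + suc s + 32 * suc s + 32 * f ≡⟨ cong (λ z → z + 32 * suc s + 32 * f) (sym m≡f+s+1) ⟩
      m + 32 * suc s + 32 * f         ∎)

  -- windows are small: 200 m² ≤ n², from 100 m ≤ 5 (n + 19) ≤ 7 n
  200m²≤n² : 200 * (m * m) ≤ n * n
  200m²≤n² = *-cancelˡ-≤ 50 (begin
    50 * (200 * (m * m))   ≡⟨ solve (m ∷ []) ⟩
    (100 * m) * (100 * m)  ≤⟨ *-mono-≤ 100m≤7n 100m≤7n ⟩
    (7 * n) * (7 * n)      ≡⟨ solve (n ∷ []) ⟩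
    49 * (n * n)           ≤⟨ *-monoˡ-≤ (n * n) (n≤1+n 49) ⟩
    50 * (n * n)           ∎)
    where
    100m≤7n : 100 * m ≤ 7 * n
    100m≤7n = begin
      100 * m        ≡⟨ solve (m ∷ []) ⟩
      5 * (m * 20)   ≤⟨ *-monoʳ-≤ 5 m*20≤n+19 ⟩
      5 * (n + 19)   ≡⟨ solve (n ∷ []) ⟩
      5 * n + 95     ≤⟨ +-monoʳ-≤ (5 * n) (≤-trans (m≤m+n 95 7) (*-monoʳ-≤ 2 51≤n)) ⟩
      5 * n + 2 * n  ≡⟨ solve (n ∷ []) ⟩
      7 * n          ∎


module WindowParameters (n : ℕ.ℕ) (51≤n : 51 ℕ.≤ n) where

  open import Data.Nat using (ℕ; zero; suc; _+_; _*_; _∸_; _≤_; _<_; s≤s; z≤n)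
  open import Data.Nat.Properties
  open import Data.Nat.DivMod using (_/_; _%_; m≡m%n+[m/n]*n; m%n<n; m/n*n≤m)
  open import Data.Empty using (⊥-elim)
  open import Relation.Binary.PropositionalEquality
  open ≤-Reasoning

  m f s : ℕ
  m = (n + 19) / 20
  f = n / 50
  s = m ∸ suc f

  m*20≤n+19 : m * 20 ≤ n + 19
  m*20≤n+19 = m/n*n≤m (n + 19) 20

  n≤m*20 : n ≤ m * 20
  n≤m*20 = +-cancelʳ-≤ 19 n (m * 20) (m<1+n⇒m≤n (begin-strict
    n + 19                    ≡⟨ m≡m%n+[m/n]*n (n + 19) 20 ⟩
    (n + 19) % 20 + m * 20    <⟨ +-monoˡ-< (m * 20) (m%n<n (n + 19) 20) ⟩
    20 + m * 20               ≡⟨ trans (+-comm 20 (m * 20)) (+-suc (m * 20) 19) ⟩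
    suc (m * 20 + 19)         ∎))

  n<50+f*50 : n < 50 + f * 50
  n<50+f*50 = begin-strict
    n                 ≡⟨ m≡m%n+[m/n]*n n 50 ⟩
    n % 50 + f * 50   <⟨ +-monoˡ-< (f * 50) (m%n<n n 50) ⟩
    50 + f * 50       ∎

  -- f < m, since 50 f ≤ n ≤ 20 m < 50 m (m > 0 as n > 0)
  f<m : f < m
  f<m = *-cancelʳ-< 50 f m (begin-strict
    f * 50    ≤⟨ m/n*n≤m n 50 ⟩
    n         ≤⟨ n≤m*20 ⟩
    m * 20    <⟨ 20m<50m m refl ⟩
    m * 50    ∎)
    where
    20m<50m : ∀ k → k ≡ m → k * 20 < k * 50
    20m<50m zero    k≡m = ⊥-elim (<⇒≱ (≤-trans (s≤s z≤n) 51≤n) (subst (λ k → n ≤ k * 20) (sym k≡m) n≤m*20))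
    20m<50m (suc k) _   = *-monoʳ-< (suc k) (m≤m+n 21 29)

  m≡f+s+1 : m ≡ f + suc s
  m≡f+s+1 = trans (sym (m+[n∸m]≡n f<m)) (sym (+-suc f s))

  open WindowArithmetic n m f s 51≤n m*20≤n+19 n≤m*20 (m/n*n≤m n 50) n<50+f*50 m≡f+s+1 public


module Dichotomy where

  open import Defs
  open FinSums
  open WindowSurgery using (backward₀; induced; windowVertex; windowVertex-injective; window-surgery)
  open ShortEdgeCover
  open import Data.Nat using (ℕ; _+_; _*_; _≤_; _≤?_)
  open import Data.Nat.Properties
  open import Data.Nat.Tactic.RingSolver using (solve)
  open import Data.List using (_∷_; [])
  open import Data.Fin using (Fin)
  import Data.Fin.Properties as FP
  open import Data.Product using (∃; ∃₂; _×_; _,_)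
  open import Data.Sum using (_⊎_; inj₁; inj₂)
  open import Relation.Nullary using (¬_; Dec; yes; no)
  open import Relation.Binary.PropositionalEquality

  absorb : ∀ (a N M X Y : ℕ) → a * N ≤ X + Y → Y ≤ 198 * (a * M) → 200 * M ≤ N → a * N ≤ 100 * X
  absorb a N M X Y aN≤X+Y Y≤ 200M≤N = *-cancelˡ-≤ 2 (+-cancelʳ-≤ (198 * (a * N)) _ _ (begin
    2 * (a * N) + 198 * (a * N)       ≡⟨ solve (a ∷ N ∷ []) ⟩
    200 * (a * N)                     ≤⟨ *-monoʳ-≤ 200 aN≤X+Y ⟩
    200 * (X + Y)                     ≤⟨ *-monoʳ-≤ 200 (+-monoʳ-≤ X Y≤) ⟩
    200 * (X + 198 * (a * M))         ≡⟨ solve (a ∷ M ∷ X ∷ []) ⟩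
    2 * (100 * X) + 198 * (a * (200 * M)) ≤⟨ +-monoʳ-≤ (2 * (100 * X)) (*-monoʳ-≤ 198 (*-monoʳ-≤ a 200M≤N)) ⟩
    2 * (100 * X) + 198 * (a * N)     ∎))
    where open ≤-Reasoning

  module _ {n : ℕ} (T : Adj n) (a D : ℕ) where

    -- at least α n²/1000 backward edges of length at least n/50
    Long : Ordering n → Set
    Long σ = a * (n * n) ≤ backwardLong T σ n 50 * (D * 1000)

    -- an injective family of at least n/20 vertices inducing a 6α-far subtournament
    FarWindow : Set
    FarWindow = ∃₂ λ (m : ℕ) (e : Fin m → Fin n) → (∀ i j → e i ≡ e j → i ≡ j) × n ≤ 20 * m ×
      (∀ T' → IsTournament T' → IsTransitive T' → 6 * a * (m * m) ≤ differ (induced T e) T' * D)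

  module _ {n : ℕ} (T : Adj n) (tT : IsTournament T) (σ : Ordering n) (σ-minimal : IsMinimalOrdering T σ)
           (a D : ℕ) (many-backward : a * (n * n) ≤ backward T σ * D) where

    small-long : n ≤ 50 → Long T a D σ
    small-long n≤50 = ≤-trans many-backward (≤-trans (*-monoˡ-≤ D (all-long T σ n 50 n≤50))
                                                    (*-monoʳ-≤ (backwardLong T σ n 50) (m≤m*n D 1000)))

    module Large (51≤n : 51 ≤ n) where
      open WindowParameters n 51≤n
      open Cover T tT σ σ-minimal m s 32 n 50 m≤n reach short-fits

      FarAt : Fin 33 → Set
      FarAt k = 6 * a * (m * m) ≤ backward₀ (windowT k) * D

      far-window : ∀ k → FarAt k → FarWindow T a D
      far-window k far = m , windowVertex T tT σ σ-minimal (startOf k) m (fits k) ,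
        windowVertex-injective T tT σ σ-minimal (startOf k) m (fits k) , subst (n ≤_) (*-comm m 20) n≤m*20 ,
        λ T' tT' trT' → ≤-trans far (*-monoˡ-≤ D (window-surgery T tT σ σ-minimal (startOf k) m (fits k) T' tT' trT'))

      -- if no window has many backward edges, the windows hold at most 99% of
      -- the α n² backward edges, so the long edges carry the rest
      no-far-window : (∀ k → ¬ FarAt k) → Long T a D σ
      no-far-window none-far = begin
        a * (n * n)             ≤⟨ absorb a (n * n) (m * m) (L * D) (sumFin (λ k → bw k * D)) covered windows 200m²≤n² ⟩
        100 * (L * D)           ≤⟨ *-monoˡ-≤ (L * D) (m≤m+n 100 900) ⟩
        1000 * (L * D)          ≡⟨ trans (*-comm 1000 (L * D)) (*-assoc L D 1000) ⟩
        L * (D * 1000)          ∎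
        where
        open ≤-Reasoning
        L = backwardLong T σ n 50
        bw = λ k → backward₀ (windowT k)
        covered : a * (n * n) ≤ L * D + sumFin (λ k → bw k * D)
        covered = ≤-trans many-backward (≤-trans (*-monoˡ-≤ D short-edge-cover)
          (≤-reflexive (trans (*-distribʳ-+ D L (sumFin bw)) (cong (L * D +_) (sum-*ʳ bw D)))))
        windows : sumFin (λ k → bw k * D) ≤ 198 * (a * (m * m))
        windows = ≤-trans (sum≤const (λ k → bw k * D) (6 * a * (m * m)) (λ k → <⇒≤ (≰⇒> (none-far k))))
                          (≤-reflexive (33·6 (m * m)))
          where
          33·6 : ∀ M → 33 * (6 * a * M) ≡ 198 * (a * M)
          33·6 M = solve (a ∷ M ∷ [])

      large-dichotomy : Long T a D σ ⊎ FarWindow T a D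
      large-dichotomy = decide (FP.any? (λ k → 6 * a * (m * m) ≤? backward₀ (windowT k) * D))
        where
        decide : Dec (∃ FarAt) → Long T a D σ ⊎ FarWindow T a D
        decide (yes (k , far)) = inj₂ (far-window k far)
        decide (no none-far)   = inj₁ (no-far-window (λ k far → none-far (k , far)))

    dichotomy : Long T a D σ ⊎ FarWindow T a D
    dichotomy with n ≤? 50
    ... | yes n≤50 = inj₁ (small-long n≤50)
    ... | no  n≰50 = Large.large-dichotomy (≰⇒> n≰50)


-- A non-negative
-- α is mkℚ (+ a) d, i.e. a/(d+1); comparisons are made on unnormalised
-- representatives, where they become cross-multiplications.
module RationalBounds where

  open import Data.Nat using (ℕ; suc; _+_; _*_; _≤_)
  open import Data.Nat.Properties using (*-identityʳ; +-identityʳ)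
  open import Data.Integer as ℤ using (+_; +≤+)
  import Data.Integer.Properties as ℤP
  open import Data.Rational as ℚ using (ℚ; mkℚ; _/_; toℚᵘ) renaming (_*_ to _*ℚ_)
  import Data.Rational.Properties as ℚP
  open import Data.Rational.Unnormalised as ℚᵘ using (ℚᵘ; mkℚᵘ; *≤*; ↥_; ↧_; ↧ₙ_)
  import Data.Rational.Unnormalised.Properties as ℚᵘP
  open import Data.Nat.Coprimality using (Coprime)
  open import Relation.Binary.PropositionalEquality

  private
    cross : ∀ (p q : ℚᵘ) {x} → ↥ p ≡ + x → + (x * ↧ₙ q) ≡ ↥ p ℤ.* ↧ q
    cross p q {x} eq = trans (ℤP.pos-* x (↧ₙ q)) (cong (ℤ._* ↧ q) (sym eq))

  ≤ᵘ-intro : ∀ {p q : ℚᵘ} {x y : ℕ} → ↥ p ≡ + x → ↥ q ≡ + y → x * ↧ₙ q ≤ y * ↧ₙ p → p ℚᵘ.≤ q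
  ≤ᵘ-intro {p} {q} ep eq le = *≤* (subst₂ ℤ._≤_ (cross p q ep) (cross q p eq) (+≤+ le))

  ≤ᵘ-elim : ∀ {p q : ℚᵘ} {x y : ℕ} → ↥ p ≡ + x → ↥ q ≡ + y → p ℚᵘ.≤ q → x * ↧ₙ q ≤ y * ↧ₙ p
  ≤ᵘ-elim {p} {q} ep eq (*≤* le) = ℤP.drop‿+≤+ (subst₂ ℤ._≤_ (sym (cross p q ep)) (sym (cross q p eq)) le)

  ≤-from-ℚᵘ : ∀ {P Q : ℚ} {P′ Q′ : ℚᵘ} → toℚᵘ P ℚᵘ.≃ P′ → toℚᵘ Q ℚᵘ.≃ Q′ → P′ ℚᵘ.≤ Q′ → P ℚ.≤ Q
  ≤-from-ℚᵘ e₁ e₂ le = ℚP.toℚᵘ-cancel-≤ (ℚᵘP.≤-respˡ-≃ (ℚᵘP.≃-sym e₁) (ℚᵘP.≤-respʳ-≃ (ℚᵘP.≃-sym e₂) le))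

  ≤-to-ℚᵘ : ∀ {P Q : ℚ} {P′ Q′ : ℚᵘ} → toℚᵘ P ℚᵘ.≃ P′ → toℚᵘ Q ℚᵘ.≃ Q′ → P ℚ.≤ Q → P′ ℚᵘ.≤ Q′
  ≤-to-ℚᵘ e₁ e₂ le = ℚᵘP.≤-respˡ-≃ e₁ (ℚᵘP.≤-respʳ-≃ e₂ (ℚP.toℚᵘ-mono-≤ le))

  integer : ∀ N → toℚᵘ ((+ N) / 1) ℚᵘ.≃ mkℚᵘ (+ N) 0
  integer N = ℚP.toℚᵘ-fromℚᵘ (mkℚᵘ (+ N) 0)

  module _ (a d : ℕ) .(coprime : Coprime a (suc d)) where

    α : ℚ
    α = mkℚ (+ a) d coprime

    α·N : ∀ N → toℚᵘ (α *ℚ ((+ N) / 1)) ℚᵘ.≃ (mkℚᵘ (+ a) d ℚᵘ.* mkℚᵘ (+ N) 0)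
    α·N N = ℚᵘP.≃-trans (ℚP.toℚᵘ-homo-* α ((+ N) / 1)) (ℚᵘP.*-congˡ {mkℚᵘ (+ a) d} (integer N))

    scaled-≤⇒ : ∀ N B → α *ℚ ((+ N) / 1) ℚ.≤ (+ B) / 1 → a * N ≤ B * suc d
    scaled-≤⇒ N B le = subst₂ _≤_ (*-identityʳ (a * N)) (cong (λ k → B * suc k) (*-identityʳ d))
      (≤ᵘ-elim {mkℚᵘ (+ a) d ℚᵘ.* mkℚᵘ (+ N) 0} {mkℚᵘ (+ B) 0} (sym (ℤP.pos-* a N)) refl
        (≤-to-ℚᵘ (α·N N) (integer B) le))

    thousandth-≤ : ∀ N L → a * N ≤ L * (suc d * 1000) → (α *ℚ ((+ N) / 1)) *ℚ ((+ 1) / 1000) ℚ.≤ (+ L) / 1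
    thousandth-≤ N L le = ≤-from-ℚᵘ {P′ = P′} {Q′ = mkℚᵘ (+ L) 0}
      (ℚᵘP.≃-trans (ℚP.toℚᵘ-homo-* (α *ℚ ((+ N) / 1)) ((+ 1) / 1000))
         (ℚᵘP.*-cong {toℚᵘ (α *ℚ ((+ N) / 1))} (α·N N) (ℚP.toℚᵘ-fromℚᵘ (mkℚᵘ (+ 1) 999))))
      (integer L)
      (≤ᵘ-intro {P′} {mkℚᵘ (+ L) 0} {a * N} {L}
         (trans (cong (ℤ._* + 1) (sym (ℤP.pos-* a N))) (ℤP.*-identityʳ (+ (a * N)))) refl
         (subst₂ _≤_ (sym (*-identityʳ (a * N))) denominator le))
      where
      P′ = (mkℚᵘ (+ a) d ℚᵘ.* mkℚᵘ (+ N) 0) ℚᵘ.* mkℚᵘ (+ 1) 999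
      denominator : L * (suc d * 1000) ≡ L * ↧ₙ P′
      denominator = cong (λ k → L * (1000 + k * 1000)) {d} {d * 1} (sym (*-identityʳ d))

    six-≤ : ∀ N X → 6 * a * N ≤ X * suc d → ((+ 6) / 1 *ℚ α) *ℚ ((+ N) / 1) ℚ.≤ (+ X) / 1
    six-≤ N X le = ≤-from-ℚᵘ {P′ = P′} {Q′ = mkℚᵘ (+ X) 0}
      (ℚᵘP.≃-trans (ℚP.toℚᵘ-homo-* ((+ 6) / 1 *ℚ α) ((+ N) / 1))
         (ℚᵘP.*-cong {toℚᵘ ((+ 6) / 1 *ℚ α)} {mkℚᵘ (+ 6) 0 ℚᵘ.* mkℚᵘ (+ a) d}
            (ℚᵘP.≃-trans (ℚP.toℚᵘ-homo-* ((+ 6) / 1) α) (ℚᵘP.*-congʳ {mkℚᵘ (+ a) d} (integer 6))) (integer N)))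
      (integer X)
      (≤ᵘ-intro {P′} {mkℚᵘ (+ X) 0} {6 * a * N} {X}
         (trans (cong (ℤ._* + N) (sym (ℤP.pos-* 6 a))) (sym (ℤP.pos-* (6 * a) N))) refl
         (subst₂ _≤_ (sym (*-identityʳ (6 * a * N)))
            denominator le))
      where
      P′ = (mkℚᵘ (+ 6) 0 ℚᵘ.* mkℚᵘ (+ a) d) ℚᵘ.* mkℚᵘ (+ N) 0
      denominator : X * suc d ≡ X * ↧ₙ P′
      denominator = cong (λ k → X * suc k) (sym (trans (*-identityʳ (d + 0)) (+-identityʳ d)))


open import Defs
open import Data.Nat using (ℕ; suc; _*_; _≥_)
open import Data.Fin using (Fin)
open import Data.Product using (∃₂; _×_; _,_)
open import Data.Sum using (_⊎_; inj₁; inj₂)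
open import Data.Integer using (+_; -[1+_])
open import Data.Rational using (ℚ; mkℚ; _/_; _≤_; _<_; 0ℚ; *<*) renaming (_*_ to _*ℚ_)
open import Function.Definitions using (Injective)
open import Relation.Binary.PropositionalEquality using (_≡_; subst)
open OrderTournament using (orderTournament; orderTournament-isTournament; orderTournament-isTransitive; differ≡backward)
open Dichotomy using (Long; FarWindow; dichotomy)
open RationalBounds using (scaled-≤⇒; thousandth-≤; six-≤)

lemma2p4 : (α : ℚ) → 0ℚ < α → (n : ℕ) → (T : Adj n) → IsTournament T →
  FarFromTransitive α T → (σ : Ordering n) → IsMinimalOrdering T σ →
  (α ·n² n) *ℚ ((+ 1) / 1000) ≤ ((+ backwardLong T σ n 50) / 1)
  ⊎ (∃₂ λ (m : ℕ) (e : Fin m → Fin n) → Injective _≡_ _≡_ e × 20 * m ≥ n ×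
      FarFromTransitive ((+ 6 / 1) *ℚ α) (λ i j → T (e i) (e j)))
-- α > 0 excludes negative numerators
lemma2p4 (mkℚ -[1+ _ ] _ _) (*<* ())
lemma2p4 α@(mkℚ (+ a) d coprime) _ n T tT far σ σ-minimal =
  conclude (dichotomy T tT σ σ-minimal a (suc d) many-backward)
  where
  -- farness applied to the transitive tournament of σ: α n² ≤ backward T σ
  many-backward : a * (n * n) ℕ.≤ backward T σ * suc d
  many-backward = scaled-≤⇒ a d coprime (n * n) (backward T σ)
    (subst (λ k → α ·n² n ≤ (+ k) / 1) (differ≡backward σ T tT)
      (far (orderTournament σ) (orderTournament-isTournament σ) (orderTournament-isTransitive σ)))

  conclude : Long T a (suc d) σ ⊎ FarWindow T a (suc d) →
    (α ·n² n) *ℚ ((+ 1) / 1000) ≤ ((+ backwardLong T σ n 50) / 1)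
    ⊎ (∃₂ λ (m : ℕ) (e : Fin m → Fin n) → Injective _≡_ _≡_ e × 20 * m ≥ n ×
        FarFromTransitive ((+ 6 / 1) *ℚ α) (λ i j → T (e i) (e j)))
  conclude (inj₁ long) = inj₁ (thousandth-≤ a d coprime (n * n) (backwardLong T σ n 50) long)
  conclude (inj₂ (m , e , e-injective , n≤20m , window-far)) = inj₂ (m , e , e-injective _ _ , n≤20m ,
    λ T' tT' trT' → six-≤ a d coprime (m * m) (differ (λ i j → T (e i) (e j)) T') (window-far T' tT' trT'))
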